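{- Let $n\ge4$. The admissible subalgebras of $K(\mathbf{DP}_n)$ are exactly the algebras $\mathbf K_n^U$, for $U$ ranging over the up-sets of $X_n$. Moreover, for up-sets $U,W$ of $X_n$, $K_n^U\subset K_n^W$ if and only if $U\subset W$.
   Context: For a bounded commutative residuated lattice $\mathbf A$ (lattice, commutative monoid $(A,\cdot,1)$ with $ab\le c$ iff $a\le b\to c$, $1$ greatest, $0$ least), $K(\mathbf A)$ is the algebra on $A\times A$ with $(a,b)\vee(c,d)=(a\vee c,b\wedge d)$, $(a,b)\wedge(c,d)=(a\wedge c,b\vee d)$, $(a,b)(c,d)=(ac,(a\to d)\wedge(c\to b))$, $(a,b)\to(c,d)=((a\to c)\wedge(d\to b),ad)$, unit $(1,1)$ and constant $0$ as $(0,1)$. A subalgebra $\mathbf S$ of $K(\mathbf A)$ is admissible if $\{s\in S: s\le (1,1)\}=\{(a,1):a\in A\}$ (i.e. its negative cone equals that of $K(\mathbf A)$). The drastic product chain $\mathbf{DP}_n$ has universe $\{0=a_{n-1}<a_{n-2}<\dots<a_1<1\}$, product $xy=0$ if $x,y\ne1$ and $xy=x\wedge y$ otherwise, and implication $x\to y=1$ if $x\le y$, $x\to y=a_1$ if $1>x>y$, $1\to y=y$. Let $K_n^\emptyset=\{(x,1),(1,x),(x,a_1),(a_1,x):x\in DP_n\}$. Let $X_n=\{(a_i,a_j):i\ge j>1\}$, ordered coordinatewise (as a subset of $DP_n\times DP_n$). For an up-set $U$ of $X_n$, $K_n^U=K_n^\emptyset\cup\{(x,y):(x,y)\in U\text{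 or }(y,x)\in U\}$ and $\mathbf K_n^U$ is the corresponding subalgebra of $K(\mathbf{DP}_n)$. -}

module Defs where

open import Data.Nat using (ℕ; zero; suc; _≤_; _<_; _≤ᵇ_)
open import Data.Fin using (Fin; toℕ; fromℕ; _≟_)
import Data.Fin as F
open import Data.Bool using (Bool; true; false; if_then_else_; _∨_)
open import Data.Product using (_×_; _,_; ∃-syntax)
open import Relation.Nullary.Decidable using (⌊_⌋)
open import Relation.Binary.PropositionalEquality using (_≡_)

-- Convention: the drastic product chain DP_n with n = m + 2 elements.
-- The element a_i (0 ≤ i ≤ n-1) is represented by i : Fin n,
-- so a_0 = 1 (top), a_1, ..., a_{n-1} = 0 (bottom).

DP : ℕ → Set
DP m = Fin (suc (suc m))

one : ∀ {m} → DP m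
one = F.zero

a₁ : ∀ {m} → DP m
a₁ = F.suc F.zero

bot : ∀ {m} → DP m
bot {m} = fromℕ (suc m)

_≤D_ : ∀ {m} → DP m → DP m → Set
x ≤D y = toℕ y ≤ toℕ x

_≤Db_ : ∀ {m} → DP m → DP m → Bool
x ≤Db y = toℕ y ≤ᵇ toℕ x

isOne : ∀ {m} → DP m → Bool
isOne x = ⌊ x ≟ one ⌋

isA₁ : ∀ {m} → DP m → Bool
isA₁ x = ⌊ x ≟ a₁ ⌋

_∧D_ : ∀ {m} → DP m → DP m → DP m
x ∧D y = if x ≤Db y then x else y

_∨D_ : ∀ {m} → DP m → DP m → DP m
x ∨D y = if x ≤Db y then y else x

_·D_ : ∀ {m} → DP m → DP m → DP m
x ·D y = if isOne x ∨ isOne y then x ∧D y else bot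

_⇒D_ : ∀ {m} → DP m → DP m → DP m
x ⇒D y = if x ≤Db y then one else (if isOne x then y else a₁)

KE : ℕ → Set
KE m = DP m × DP m

_∨K_ : ∀ {m} → KE m → KE m → KE m
(a , b) ∨K (c , d) = (a ∨D c , b ∧D d)

_∧K_ : ∀ {m} → KE m → KE m → KE m
(a , b) ∧K (c , d) = (a ∧D c , b ∨D d)

_·K_ : ∀ {m} → KE m → KE m → KE m
(a , b) ·K (c , d) = (a ·D c , (a ⇒D d) ∧D (c ⇒D b))

_⇒K_ : ∀ {m} → KE m → KE m → KE m
(a , b) ⇒K (c , d) = ((a ⇒D c) ∧D (d ⇒D b) , a ·D d)

1K : ∀ {m} → KE m
1K = (one , one)

0K : ∀ {m} → KE m
0K = (bot , one)

_≤K_ : ∀ {m} → KE m → KE m → Set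
s ≤K t = (s ∧K t) ≡ s

KSub : ℕ → Set
KSub m = DP m → DP m → Bool

_∈K_ : ∀ {m} → KE m → KSub m → Set
(x , y) ∈K S = S x y ≡ true

_⊆K_ : ∀ {m} → KSub m → KSub m → Set
S ⊆K T = ∀ x y → S x y ≡ true → T x y ≡ true

record IsSubalgebra {m} (S : KSub m) : Set where
  field
    has-1 : 1K ∈K S
    has-0 : 0K ∈K S
    closed-∨ : ∀ s t → s ∈K S → t ∈K S → (s ∨K t) ∈K S
    closed-∧ : ∀ s t → s ∈K S → t ∈K S → (s ∧K t) ∈K S
    closed-· : ∀ s t → s ∈K S → t ∈K S → (s ·K t) ∈K S
    closed-⇒ : ∀ s t → s ∈K S → t ∈K S → (s ⇒K t) ∈K S

IsAdmissible : ∀ {m} → KSub m → Set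
IsAdmissible {m} S =
  (s : KE m) → ((s ∈K S × s ≤K 1K) → ∃[ a ] s ≡ (a , one))
             × (∃[ a ] s ≡ (a , one) → (s ∈K S × s ≤K 1K))

IsAdmissibleSubalgebra : ∀ {m} → KSub m → Set
IsAdmissibleSubalgebra S = IsSubalgebra S × IsAdmissible S

InX : ∀ {m} → DP m → DP m → Set
InX x y = toℕ y ≤ toℕ x × 1 < toℕ y

_≤X_ : ∀ {m} → KE m → KE m → Set
(a , b) ≤X (c , d) = a ≤D c × b ≤D d

record IsUpSet {m} (U : KSub m) : Set where
  field
    ⊆X : ∀ x y → U x y ≡ true → InX x y
    up : ∀ x y x' y' → U x y ≡ true → InX x' y' →
         (x , y) ≤X (x' , y') → U x' y' ≡ true

K∅ : ∀ {m} → KSub m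
K∅ x y = isOne y ∨ isOne x ∨ isA₁ y ∨ isA₁ x

KU : ∀ {m} → KSub m → KSub m
KU U x y = K∅ x y ∨ U x y ∨ U y x

-- An admissible subalgebra of K(DP_n) is the same thing as a symmetric up-set of
-- DP_n × DP_n (coordinatewise order) containing (a₁ , 0).  Such a set is closed under ∨
-- by upward closure, and under · because a product either has first coordinate 0 and
-- second coordinate in {1 , a₁}, or (when a first coordinate is 1) is the other factor
-- with its second coordinate met with an element of {1 , a₁}; closure under ∧ and →
-- then follows by symmetry.  Conversely, in an admissible subalgebra S the swap
-- (x , y) ↦ (y , x) of pairs below 1 is s ↦ s → (0 , 1), and s ∨ (x' , 1) raises the
-- first coordinate to x', so S is a symmetric up-set.  A symmetric up-set is determined
-- by its trace on X_n, which is an up-set of X_n.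
module Submission where

open import Defs
open import Data.Nat using (ℕ; suc; _≤_)
open import Data.Product using (_×_; ∃-syntax)
open import Function.Bundles using (_⇔_)
open import Relation.Binary.PropositionalEquality using (_≡_)

open import Data.Bool using (true; false; _∨_; _∧_)
open import Data.Bool.Properties using (∨-comm; ⇔→≡)
open import Data.Empty using (⊥-elim)
open import Data.Fin using (Fin; toℕ)
import Data.Fin as F
import Data.Fin.Properties as FinP
open import Data.Nat using (zero; z≤n; s≤s; _<_; _≤?_; _<?_)
import Data.Nat.Properties as ℕ
open import Data.Product using (_,_; proj₁; proj₂)
open import Data.Sum using (_⊎_; inj₁; inj₂)
open import Function.Bundles using (mk⇔)
open import Relation.Nullary using (Dec; yes; no; does; _×-dec_)
open import Relation.Nullary.Decidable using (dec-true)
open import Relation.Nullary.Reflects using (ofʸ; ofⁿ)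
open import Relation.Binary.PropositionalEquality using (refl; sym; trans; subst; subst₂)

∨-elim-true : ∀ a b → a ∨ b ≡ true → a ≡ true ⊎ b ≡ true
∨-elim-true true  _ _ = inj₁ refl
∨-elim-true false _ e = inj₂ e

∨-introˡ-true : ∀ {a} b → a ≡ true → a ∨ b ≡ true
∨-introˡ-true _ refl = refl

∨-introʳ-true : ∀ a {b} → b ≡ true → a ∨ b ≡ true
∨-introʳ-true true  _ = refl
∨-introʳ-true false e = e

∨-mono-true : ∀ {a a' b b'} → (a ≡ true → a' ≡ true) → (b ≡ true → b' ≡ true) →
              a ∨ b ≡ true → a' ∨ b' ≡ true
∨-mono-true {a} {a'} {b} {b'} f g e with ∨-elim-true a b e
... | inj₁ ea = ∨-introˡ-true b' (f ea)
... | inj₂ eb = ∨-introʳ-true a' (g eb)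

∧-elim-true : ∀ a b → a ∧ b ≡ true → a ≡ true × b ≡ true
∧-elim-true true _ e = refl , e

∧-intro-true : ∀ {a b} → a ≡ true → b ≡ true → a ∧ b ≡ true
∧-intro-true refl refl = refl

dec-true⁻¹ : ∀ {A : Set} (a? : Dec A) → does a? ≡ true → A
dec-true⁻¹ (yes a) _ = a

module _ {m : ℕ} where

  data Upper : DP m → Set where
    top    : Upper one
    coatom : Upper a₁

  data Low : DP m → Set where
    low : (k : Fin m) → Low (F.suc (F.suc k))

  upper-or-low : (x : DP m) → Upper x ⊎ Low x
  upper-or-low F.zero             = inj₁ top
  upper-or-low (F.suc F.zero)     = inj₁ coatom
  upper-or-low (F.suc (F.suc k))  = inj₂ (low k)

  Low⇒1< : ∀ {x} → Low x → 1 < toℕ x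
  Low⇒1< (low _) = s≤s (s≤s z≤n)

  1<⇒Low : ∀ {x} → 1 < toℕ x → Low x
  1<⇒Low {F.zero}          ()
  1<⇒Low {F.suc F.zero}    (s≤s ())
  1<⇒Low {F.suc (F.suc k)} _ = low k

  Low-down : ∀ {x y} → x ≤D y → Low y → Low x
  Low-down {F.zero}          () (low _)
  Low-down {F.suc F.zero}    (s≤s ()) (low _)
  Low-down {F.suc (F.suc k)} _ _ = low k

  bot-least : (y : DP m) → bot ≤D y
  bot-least y = ℕ.≤-trans (FinP.toℕ≤pred[n] y) (ℕ.≤-reflexive (sym (FinP.toℕ-fromℕ (suc m))))

  ∨D-sel : (x y : DP m) → (x ∨D y ≡ y × x ≤D y) ⊎ (x ∨D y ≡ x × y ≤D x)
  ∨D-sel x y with x ≤Db y | ℕ.≤ᵇ-reflects-≤ (toℕ y) (toℕ x)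
  ... | true  | ofʸ x≤y = inj₁ (refl , x≤y)
  ... | false | ofⁿ x≰y = inj₂ (refl , ℕ.≰⇒≥ x≰y)

  ∨D-le : {x y : DP m} → x ≤D y → x ∨D y ≡ y
  ∨D-le {x} {y} x≤y with x ≤Db y | ℕ.≤ᵇ-reflects-≤ (toℕ y) (toℕ x)
  ... | true  | _       = refl
  ... | false | ofⁿ x≰y = ⊥-elim (x≰y x≤y)

  ∧D-sel : (x y : DP m) → x ∧D y ≡ x ⊎ x ∧D y ≡ y
  ∧D-sel x y with x ≤Db y
  ... | true  = inj₁ refl
  ... | false = inj₂ refl

  ∧D-preserves : (P : DP m → Set) {x y : DP m} → P x → P y → P (x ∧D y)
  ∧D-preserves P {x} {y} px py with ∧D-sel x y
  ... | inj₁ e = subst P (sym e) px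
  ... | inj₂ e = subst P (sym e) py

  ⇒D-identityˡ : (x : DP m) → one ⇒D x ≡ x
  ⇒D-identityˡ F.zero    = refl
  ⇒D-identityˡ (F.suc _) = refl

  ·D-identityʳ : (x : DP m) → x ·D one ≡ x
  ·D-identityʳ F.zero    = refl
  ·D-identityʳ (F.suc _) = refl

  Upper-∧D-below : ∀ {w} → Upper w → (x : Fin (suc m)) → w ∧D F.suc x ≡ F.suc x
  Upper-∧D-below top    _         = refl
  Upper-∧D-below coatom F.zero    = refl
  Upper-∧D-below coatom (F.suc _) = refl

  ⇒D-Upper : (x : Fin (suc m)) (z : DP m) → Upper (F.suc x ⇒D z)
  ⇒D-Upper x z with F.suc x ≤Db z
  ... | true  = top
  ... | false = coatom

  K∅-upperˡ : ∀ {x} → Upper x → (y : DP m) → K∅ x y ≡ true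
  K∅-upperˡ top    F.zero            = refl
  K∅-upperˡ top    (F.suc _)         = refl
  K∅-upperˡ coatom F.zero            = refl
  K∅-upperˡ coatom (F.suc F.zero)    = refl
  K∅-upperˡ coatom (F.suc (F.suc _)) = refl

  K∅-upperʳ : (x : DP m) → ∀ {y} → Upper y → K∅ x y ≡ true
  K∅-upperʳ _         top    = refl
  K∅-upperʳ F.zero    coatom = refl
  K∅-upperʳ (F.suc _) coatom = refl

  KU-upperˡ : (U : KSub m) → ∀ {x} → Upper x → (y : DP m) → KU U x y ≡ true
  KU-upperˡ U {x} ux y = ∨-introˡ-true (U x y ∨ U y x) (K∅-upperˡ ux y)

  KU-upperʳ : (U : KSub m) → (x : DP m) → ∀ {y} → Upper y → KU U x y ≡ true
  KU-upperʳ U x {y} uy = ∨-introˡ-true (U x y ∨ U y x) (K∅-upperʳ x uy)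

  KU-low : (U : KSub m) → ∀ {x y} → Low x → Low y → KU U x y ≡ U x y ∨ U y x
  KU-low U (low _) (low _) = refl

record IsSymmetricUpSet {m} (T : KSub m) : Set where
  field
    symmetric : ∀ {x y} → T x y ≡ true → T y x ≡ true
    upˡ       : ∀ {x y x'} → T x y ≡ true → x ≤D x' → T x' y ≡ true
    a₁-bot∈   : (a₁ , bot) ∈K T

  upʳ : ∀ {x y y'} → T x y ≡ true → y ≤D y' → T x y' ≡ true
  upʳ h le = symmetric (upˡ (symmetric h) le)

  upperˡ : ∀ {x} → Upper x → (y : DP m) → T x y ≡ true
  upperˡ top    y = upˡ (upperˡ coatom y) z≤n
  upperˡ coatom y = upʳ a₁-bot∈ (bot-least y)

  upperʳ : (x : DP m) → ∀ {y} → Upper y → T x y ≡ true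
  upperʳ x uy = symmetric (upperˡ uy x)

  ∨-closed : ∀ {a b c d} → T a b ≡ true → T c d ≡ true → T (a ∨D c) (b ∧D d) ≡ true
  ∨-closed {a} {b} {c} {d} hab hcd with ∨D-sel a c | ∧D-sel b d
  ... | inj₁ (e , a≤c) | inj₁ e' = subst₂ (λ p q → T p q ≡ true) (sym e) (sym e') (upˡ hab a≤c)
  ... | inj₁ (e , _)   | inj₂ e' = subst₂ (λ p q → T p q ≡ true) (sym e) (sym e') hcd
  ... | inj₂ (e , _)   | inj₁ e' = subst₂ (λ p q → T p q ≡ true) (sym e) (sym e') hab
  ... | inj₂ (e , c≤a) | inj₂ e' = subst₂ (λ p q → T p q ≡ true) (sym e) (sym e') (upˡ hcd c≤a)

  ·-closed : ∀ {a b c d} → T a b ≡ true → T c d ≡ true →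
             T (a ·D c) ((a ⇒D d) ∧D (c ⇒D b)) ≡ true
  ·-closed {F.zero}  {b} {F.zero}  {d} _ _ = upperˡ top _
  ·-closed {F.zero}  {b} {F.suc c} {d} _ hcd rewrite ⇒D-identityˡ d =
    ∧D-preserves (λ w → T (F.suc c) w ≡ true) hcd (upperʳ _ (⇒D-Upper c b))
  ·-closed {F.suc a} {b} {F.zero}  {d} hab _ rewrite ⇒D-identityˡ b =
    ∧D-preserves (λ w → T (F.suc a) w ≡ true) (upperʳ _ (⇒D-Upper a d)) hab
  ·-closed {F.suc a} {b} {F.suc c} {d} _ _ =
    upperʳ _ (∧D-preserves Upper (⇒D-Upper a d) (⇒D-Upper c b))

  -- ∧ and → are the De Morgan duals of ∨ and · under (a , b) ↦ (b , a), definitionally.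
  isSubalgebra : IsSubalgebra T
  isSubalgebra = record
    { has-1    = upperˡ top one
    ; has-0    = upperʳ bot top
    ; closed-∨ = λ { (a , b) (c , d) → ∨-closed }
    ; closed-∧ = λ { (a , b) (c , d) hab hcd → symmetric (∨-closed (symmetric hab) (symmetric hcd)) }
    ; closed-· = λ { (a , b) (c , d) → ·-closed }
    ; closed-⇒ = λ { (a , b) (c , d) hab hcd → symmetric (·-closed hab (symmetric hcd)) }
    }

  isAdmissible : IsAdmissible T
  isAdmissible (a , b) = (λ { (_ , e) → a , sym e }) , λ { (a' , refl) → upperʳ a' top , refl }

  isAdmissibleSubalgebra : IsAdmissibleSubalgebra T
  isAdmissibleSubalgebra = isSubalgebra , isAdmissible

IsSymmetricUpSet-resp : ∀ {m} {S T : KSub m} → (∀ x y → S x y ≡ T x y) →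
                        IsSymmetricUpSet T → IsSymmetricUpSet S
IsSymmetricUpSet-resp {S = S} {T} S≗T H = record
  { symmetric = λ h → from (symmetric (to h))
  ; upˡ       = λ h le → from (upˡ (to h) le)
  ; a₁-bot∈   = from a₁-bot∈
  }
  where
    open IsSymmetricUpSet H
    to : ∀ {x y} → S x y ≡ true → T x y ≡ true
    to {x} {y} = trans (sym (S≗T x y))
    from : ∀ {x y} → T x y ≡ true → S x y ≡ true
    from {x} {y} = trans (S≗T x y)

module _ {m : ℕ} {U : KSub m} (U-up : IsUpSet U) where
  open IsUpSet U-up

  symmetrised-upˡ : ∀ {x y c} → U x y ∨ U y x ≡ true → x ≤D c → 1 < toℕ c →
               U c y ∨ U y c ≡ true
  symmetrised-upˡ {x} {y} {c} h x≤c 1<c with ∨-elim-true (U x y) (U y x) h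
  ... | inj₂ uyx =
    ∨-introʳ-true (U c y) (up y x y c uyx (ℕ.≤-trans x≤c (proj₁ (⊆X y x uyx)) , 1<c) (ℕ.≤-refl , x≤c))
  ... | inj₁ uxy with toℕ y ≤? toℕ c
  ...   | yes y≤c = ∨-introˡ-true (U y c) (up x y c y uxy (y≤c , proj₂ (⊆X x y uxy)) (x≤c , ℕ.≤-refl))
  ...   | no  y≰c = let c≤y = ℕ.<⇒≤ (ℕ.≰⇒> y≰c) in
    ∨-introʳ-true (U c y) (up x y y c uxy (c≤y , 1<c) (proj₁ (⊆X x y uxy) , c≤y))

  KU-isSymmetricUpSet : IsSymmetricUpSet (KU U)
  KU-isSymmetricUpSet = record
    { symmetric = λ {x} {y} → symmetric {x} {y}
    ; upˡ       = λ {x} {y} {c} → upˡ {x} {y} {c}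
    ; a₁-bot∈   = KU-upperˡ U coatom bot
    }
    where
      symmetric : ∀ {x y} → KU U x y ≡ true → KU U y x ≡ true
      symmetric {x} {y} h with upper-or-low x | upper-or-low y
      ... | inj₁ ux | _       = KU-upperʳ U y ux
      ... | inj₂ _  | inj₁ uy = KU-upperˡ U uy x
      ... | inj₂ lx | inj₂ ly rewrite KU-low U lx ly | KU-low U ly lx =
        trans (∨-comm (U y x) (U x y)) h

      upˡ : ∀ {x y c} → KU U x y ≡ true → x ≤D c → KU U c y ≡ true
      upˡ {x} {y} {c} h x≤c with upper-or-low c | upper-or-low y
      ... | inj₁ uc | _       = KU-upperˡ U uc y
      ... | inj₂ _  | inj₁ uy = KU-upperʳ U c uy
      ... | inj₂ lc | inj₂ ly rewrite KU-low U lc ly | KU-low U (Low-down x≤c lc) ly =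
        symmetrised-upˡ h x≤c (Low⇒1< lc)

inX? : ∀ {m} (x y : DP m) → Dec (InX x y)
inX? x y = (toℕ y ≤? toℕ x) ×-dec (1 <? toℕ y)

traceX : ∀ {m} → KSub m → KSub m
traceX T x y = T x y ∧ does (inX? x y)

module _ {m : ℕ} {T : KSub m} (H : IsSymmetricUpSet T) where
  open IsSymmetricUpSet H

  traceX-isUpSet : IsUpSet (traceX T)
  traceX-isUpSet = record
    { ⊆X = λ x y h → dec-true⁻¹ (inX? x y) (proj₂ (∧-elim-true (T x y) _ h))
    ; up = λ x y x' y' h inX' (x≤x' , y≤y') →
        ∧-intro-true (upʳ (upˡ (proj₁ (∧-elim-true (T x y) _ h)) x≤x') y≤y') (dec-true (inX? x' y') inX')
    }

  ⊆KU-traceX : T ⊆K KU (traceX T)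
  ⊆KU-traceX x y h with upper-or-low x | upper-or-low y
  ... | inj₁ ux | _       = KU-upperˡ (traceX T) ux y
  ... | inj₂ _  | inj₁ uy = KU-upperʳ (traceX T) x uy
  ... | inj₂ lx | inj₂ ly rewrite KU-low (traceX T) lx ly with toℕ y ≤? toℕ x
  ...   | yes y≤x = ∨-introˡ-true (traceX T y x)
                      (∧-intro-true h (dec-true (inX? x y) (y≤x , Low⇒1< ly)))
  ...   | no  y≰x = ∨-introʳ-true (traceX T x y)
                      (∧-intro-true (symmetric h) (dec-true (inX? y x) (ℕ.<⇒≤ (ℕ.≰⇒> y≰x) , Low⇒1< lx)))

  KU-traceX-⊆ : KU (traceX T) ⊆K T
  KU-traceX-⊆ x y h with upper-or-low x | upper-or-low y
  ... | inj₁ ux | _       = upperˡ ux y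
  ... | inj₂ _  | inj₁ uy = upperʳ x uy
  ... | inj₂ lx | inj₂ ly rewrite KU-low (traceX T) lx ly
    with ∨-elim-true (traceX T x y) (traceX T y x) h
  ...   | inj₁ t = proj₁ (∧-elim-true (T x y) _ t)
  ...   | inj₂ t = symmetric (proj₁ (∧-elim-true (T y x) _ t))

  ≗KU-traceX : ∀ x y → T x y ≡ KU (traceX T) x y
  ≗KU-traceX x y = ⇔→≡ (mk⇔ (⊆KU-traceX x y) (KU-traceX-⊆ x y))

admissible⇒isSymmetricUpSet : ∀ {m} {S : KSub (suc (suc m))} →
                              IsAdmissibleSubalgebra S → IsSymmetricUpSet S
admissible⇒isSymmetricUpSet {m} {S} (sub , adm) = record
  { symmetric = λ {x} {y} → symmetric {x} {y}
  ; upˡ       = upˡ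
  ; a₁-bot∈   = a₁-bot∈
  }
  where
    open IsSubalgebra sub

    a₂ : DP (suc (suc m))
    a₂ = F.suc a₁

    right-one∈ : ∀ x → S x one ≡ true
    right-one∈ x = proj₁ (proj₂ (adm (x , one)) (x , refl))

    left-one∈ : ∀ x → S one x ≡ true
    left-one∈ x = subst (λ q → S one q ≡ true) (·D-identityʳ x)
                    (closed-⇒ (x , one) (one , one) (right-one∈ x) (right-one∈ one))

    swap-below-one : ∀ x y → S (F.suc x) (F.suc y) ≡ true → S (F.suc y) (F.suc x) ≡ true
    swap-below-one x y h = subst (λ q → S q (F.suc x) ≡ true) (Upper-∧D-below (⇒D-Upper x bot) y)
                             (closed-⇒ (F.suc x , F.suc y) (bot , one) h has-0)

    symmetric : ∀ {x y} → S x y ≡ true → S y x ≡ true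
    symmetric {F.zero}  {y}       _ = right-one∈ y
    symmetric {F.suc x} {F.zero}  _ = left-one∈ (F.suc x)
    symmetric {F.suc x} {F.suc y} h = swap-below-one x y h

    upˡ : ∀ {x y x'} → S x y ≡ true → x ≤D x' → S x' y ≡ true
    upˡ {x} {y} {x'} h x≤x' = subst (λ w → S w y ≡ true) (∨D-le x≤x')
                                 (closed-∨ (x , y) (x' , one) h (right-one∈ x'))

    -- Here n ≥ 4 is used: a₁ → a₂ = a₁ and a₂ → 0 = a₁ need 1 > a₁ > a₂ > 0.
    a₁-bot∈ : S a₁ bot ≡ true
    a₁-bot∈ = closed-⇒ (a₁ , a₁) (a₂ , a₁)
                (closed-⇒ (a₁ , one) (bot , one) (right-one∈ a₁) has-0)
                (symmetric (closed-⇒ (a₂ , one) (bot , one) (right-one∈ a₂) has-0))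

KU-mono : ∀ {m} {U W : KSub m} → U ⊆K W → KU U ⊆K KU W
KU-mono U⊆W x y = ∨-mono-true {K∅ x y} (λ k → k) (∨-mono-true (U⊆W x y) (U⊆W y x))

InX-antisym : ∀ {m} {x y : DP m} → InX x y → InX y x → x ≡ y
InX-antisym (y≤x , _) (x≤y , _) = FinP.toℕ-injective (ℕ.≤-antisym x≤y y≤x)

KU-⊆⇒⊆ : ∀ {m} {U W : KSub m} → IsUpSet U → IsUpSet W → KU U ⊆K KU W → U ⊆K W
KU-⊆⇒⊆ {U = U} {W} U-up W-up KU⊆ x y u with ∨-elim-true (W x y) (W y x) W∨
  where
    inX : InX x y
    inX = IsUpSet.⊆X U-up x y u
    W∨ : W x y ∨ W y x ≡ true
    W∨ = subst (_≡ true) (KU-low W (1<⇒Low (ℕ.<-≤-trans (proj₂ inX) (proj₁ inX))) (1<⇒Low (proj₂ inX)))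
           (KU⊆ x y (∨-introʳ-true (K∅ x y) (∨-introˡ-true (U y x) u)))
... | inj₁ w = w
... | inj₂ w = subst₂ (λ p q → W p q ≡ true) e (sym e) w
  where
    e : y ≡ x
    e = InX-antisym (IsUpSet.⊆X W-up y x w) (IsUpSet.⊆X U-up x y u)

theorem3p6 : (m : ℕ) → 2 ≤ m →
    ((S : KSub m) →
      IsAdmissibleSubalgebra S ⇔ (∃[ U ] (IsUpSet U × (∀ x y → S x y ≡ KU U x y))))
    × ((U W : KSub m) → IsUpSet U → IsUpSet W → (KU U ⊆K KU W ⇔ U ⊆K W))
theorem3p6 zero          ()
theorem3p6 (suc zero)    (s≤s ())
theorem3p6 (suc (suc m)) _ =
  (λ S → mk⇔ (λ S-adm → let H = admissible⇒isSymmetricUpSet S-adm in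
                           traceX S , traceX-isUpSet H , ≗KU-traceX H)
             (λ { (U , U-up , S≗KU) → IsSymmetricUpSet.isAdmissibleSubalgebra
                                        (IsSymmetricUpSet-resp S≗KU (KU-isSymmetricUpSet U-up)) }))
  , λ U W U-up W-up → mk⇔ (KU-⊆⇒⊆ U-up W-up) KU-mono
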